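{- Let $A$ be an MV-algebra and let $\mathcal I(A)=(I(A),0,1,\iota,\neg,\Delta,\nabla,\oplus,\odot)$ be its algebra of intervals. Then $\mathcal I(A)$ satisfies the following equations (for all $x,y,z$): (1) $x\oplus(y\oplus z)=(x\oplus y)\oplus z$; (2) $x\oplus y=y\oplus x$; (3) $x\oplus 0=x$; (4) $x\oplus\neg 0=\neg 0$; (5) $\neg\neg x=x$; (6) $\neg(\neg\Delta x\oplus\Delta y)\oplus\Delta y=\neg(\neg\Delta y\oplus\Delta x)\oplus\Delta x$; (7) $x\odot y=\neg(\neg x\oplus\neg y)$; (8) $1=\neg 0$; (9) $\nabla x=\neg\Delta\neg x$; (10) $\neg\iota=\iota$; (11) $\Delta 0=0$; (12) $\Delta 1=1$; (13) $\Delta\iota=0$; (14) $\Delta\Delta x=\Delta x$; (15) $\Delta\nabla x=\nabla x$; (16) $\Delta(x\oplus y)=\Delta x\oplus\Delta y$; (17) $\Delta(x\odot y)=\Delta x\odot\Delta y$; (18) $\Delta x\odot\neg\nabla x=0$; (19) $\Delta x\oplus(\iota\odot\nabla x\odot\neg\Delta x)=x$.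
   Context: Let $A=(A,0,1,\neg,\oplus,\odot)$ be an MV-algebra with natural order $\leq$. An interval of $A$ is a set $[\alpha,\beta]=\{\xi\in A\mid\alpha\leq\xi\leq\beta\}$ with $\alpha\leq\beta$; $I(A)$ is the set of all intervals. The algebra $\mathcal I(A)$ has constants $0=[0,0]$, $1=[1,1]$, $\iota=A=[0,1]$, and operations $\neg x=\{\neg\alpha\mid\alpha\in x\}$, $x\oplus y=\{\alpha\oplus\beta\mid\alpha\in x,\beta\in y\}$, $x\odot y=\{\alpha\odot\beta\mid\alpha\in x,\beta\in y\}$ (these sets are again intervals), $\Delta[\alpha,\beta]=[\alpha,\alpha]$, $\nabla[\alpha,\beta]=[\beta,\beta]$. -}

module Defs where

open import Level using (Level; suc)
open import Data.Product using (Σ; ∃; _×_; _,_)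
open import Relation.Binary.PropositionalEquality using (_≡_)
open import Relation.Unary using (Pred; _≐_)

record MVAlgebra (a : Level) : Set (suc a) where
  infixl 6 _⊕_ _⊙_
  infix 8 ~_
  field
    Carrier : Set a
    𝟘 𝟙     : Carrier
    ~_      : Carrier → Carrier
    _⊕_     : Carrier → Carrier → Carrier
    _⊙_     : Carrier → Carrier → Carrier
    ⊕-assoc : ∀ x y z → x ⊕ (y ⊕ z) ≡ (x ⊕ y) ⊕ z
    ⊕-comm  : ∀ x y → x ⊕ y ≡ y ⊕ x
    ⊕-id    : ∀ x → x ⊕ 𝟘 ≡ x
    ⊕-abs   : ∀ x → x ⊕ ~ 𝟘 ≡ ~ 𝟘
    ~~      : ∀ x → ~ ~ x ≡ x
    łuk     : ∀ x y → ~ (~ x ⊕ y) ⊕ y ≡ ~ (~ y ⊕ x) ⊕ x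
    𝟙-def   : 𝟙 ≡ ~ 𝟘
    ⊙-def   : ∀ x y → x ⊙ y ≡ ~ (~ x ⊕ ~ y)

  _≤_ : Carrier → Carrier → Set a
  x ≤ y = ~ x ⊕ y ≡ 𝟙

module Intervals {a : Level} (A : MVAlgebra a) where
  open MVAlgebra A

  Subset : Set (suc a)
  Subset = Pred Carrier a

  ⟦_,_⟧ : Carrier → Carrier → Subset
  ⟦ α , β ⟧ ξ = α ≤ ξ × ξ ≤ β

  IsInterval : Subset → Set a
  IsInterval x = ∃ λ α → ∃ λ β → α ≤ β × (x ≐ ⟦ α , β ⟧)

  I0 I1 Iι : Subset
  I0 = ⟦ 𝟘 , 𝟘 ⟧
  I1 = ⟦ 𝟙 , 𝟙 ⟧
  Iι = ⟦ 𝟘 , 𝟙 ⟧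

  I¬ : Subset → Subset
  I¬ x ξ = ∃ λ α → x α × ξ ≡ ~ α

  _I⊕_ _I⊙_ : Subset → Subset → Subset
  (x I⊕ y) ξ = ∃ λ α → ∃ λ β → x α × y β × ξ ≡ α ⊕ β
  (x I⊙ y) ξ = ∃ λ α → ∃ λ β → x α × y β × ξ ≡ α ⊙ β

  IΔ I∇ : Subset → Subset
  IΔ x ξ = ∃ λ α → ∃ λ β → α ≤ β × (x ≐ ⟦ α , β ⟧) × ⟦ α , α ⟧ ξ
  I∇ x ξ = ∃ λ α → ∃ λ β → α ≤ β × (x ≐ ⟦ α , β ⟧) × ⟦ β , β ⟧ ξ

-- An interval of an MV-algebra is determined by its endpoints (the natural order is
-- antisymmetric), and the pointwise operations act on endpoints:
-- ¬[α,β] = [¬β,¬α] and [α,β] ⊕ [γ,δ] = [α⊕γ, β⊕δ], where the inclusion ⊇ is the Riesz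
-- decomposition property: ξ ≤ p ⊕ q splits as ξ = u ⊕ v with u ≤ p and v ≤ q.
-- Each of the nineteen equations thereby reduces to an MV-algebra identity between endpoints.
module Submission where

open import Defs
open import Level using (Level)
open import Data.Product using (_×_; _,_; ∃₂; proj₁; proj₂)
open import Relation.Unary using (_⊆_; _≐_)
open import Relation.Unary.Properties using (≐-refl; ≐-sym; ≐-trans)
open import Relation.Binary.PropositionalEquality
  using (_≡_; refl; sym; trans; cong; cong₂; subst; subst₂; module ≡-Reasoning)

module MVProperties {a : Level} (A : MVAlgebra a) where
  open MVAlgebra A renaming (_≤_ to infix 4 _≤_)
  open ≡-Reasoning

  infixl 6 _⊖_
  _⊖_ : Carrier → Carrier → Carrier
  x ⊖ y = x ⊙ ~ y

  ⊕-identityˡ : ∀ x → 𝟘 ⊕ x ≡ x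
  ⊕-identityˡ x = trans (⊕-comm 𝟘 x) (⊕-id x)

  ⊕-zeroʳ : ∀ x → x ⊕ 𝟙 ≡ 𝟙
  ⊕-zeroʳ x = trans (cong (x ⊕_) 𝟙-def) (trans (⊕-abs x) (sym 𝟙-def))

  ⊕-zeroˡ : ∀ x → 𝟙 ⊕ x ≡ 𝟙
  ⊕-zeroˡ x = trans (⊕-comm 𝟙 x) (⊕-zeroʳ x)

  ⊕-interchange : ∀ x y z w → (x ⊕ y) ⊕ (z ⊕ w) ≡ (x ⊕ z) ⊕ (y ⊕ w)
  ⊕-interchange x y z w = begin
    (x ⊕ y) ⊕ (z ⊕ w)   ≡⟨ sym (⊕-assoc x y (z ⊕ w)) ⟩
    x ⊕ (y ⊕ (z ⊕ w))   ≡⟨ cong (x ⊕_) (⊕-assoc y z w) ⟩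
    x ⊕ ((y ⊕ z) ⊕ w)   ≡⟨ cong (λ t → x ⊕ (t ⊕ w)) (⊕-comm y z) ⟩
    x ⊕ ((z ⊕ y) ⊕ w)   ≡⟨ cong (x ⊕_) (sym (⊕-assoc z y w)) ⟩
    x ⊕ (z ⊕ (y ⊕ w))   ≡⟨ ⊕-assoc x z (y ⊕ w) ⟩
    (x ⊕ z) ⊕ (y ⊕ w)   ∎

  ~𝟙≡𝟘 : ~ 𝟙 ≡ 𝟘
  ~𝟙≡𝟘 = trans (cong ~_ 𝟙-def) (~~ 𝟘)

  ~-⊙ : ∀ x y → ~ (x ⊙ y) ≡ ~ x ⊕ ~ y
  ~-⊙ x y = trans (cong ~_ (⊙-def x y)) (~~ (~ x ⊕ ~ y))

  ~-⊕ : ∀ x y → ~ (x ⊕ y) ≡ ~ x ⊙ ~ y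
  ~-⊕ x y = sym (trans (⊙-def (~ x) (~ y)) (cong₂ (λ s t → ~ (s ⊕ t)) (~~ x) (~~ y)))

  ⊙-zeroˡ : ∀ x → 𝟘 ⊙ x ≡ 𝟘
  ⊙-zeroˡ x = begin
    𝟘 ⊙ x           ≡⟨ ⊙-def 𝟘 x ⟩
    ~ (~ 𝟘 ⊕ ~ x)   ≡⟨ cong ~_ (trans (⊕-comm (~ 𝟘) (~ x)) (⊕-abs (~ x))) ⟩
    ~ ~ 𝟘           ≡⟨ ~~ 𝟘 ⟩
    𝟘               ∎

  ⊙-identityˡ : ∀ x → 𝟙 ⊙ x ≡ x
  ⊙-identityˡ x = begin
    𝟙 ⊙ x           ≡⟨ ⊙-def 𝟙 x ⟩
    ~ (~ 𝟙 ⊕ ~ x)   ≡⟨ cong (λ t → ~ (t ⊕ ~ x)) ~𝟙≡𝟘 ⟩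
    ~ (𝟘 ⊕ ~ x)     ≡⟨ cong ~_ (⊕-identityˡ (~ x)) ⟩
    ~ ~ x           ≡⟨ ~~ x ⟩
    x               ∎

  ~x⊕x≡𝟙 : ∀ x → ~ x ⊕ x ≡ 𝟙
  ~x⊕x≡𝟙 x = begin
    ~ x ⊕ x               ≡⟨ cong (λ t → ~ t ⊕ x) (sym (⊕-identityˡ x)) ⟩
    ~ (𝟘 ⊕ x) ⊕ x         ≡⟨ cong (λ t → ~ (t ⊕ x) ⊕ x) (sym ~𝟙≡𝟘) ⟩
    ~ (~ 𝟙 ⊕ x) ⊕ x       ≡⟨ sym (łuk x 𝟙) ⟩
    ~ (~ x ⊕ 𝟙) ⊕ 𝟙       ≡⟨ ⊕-zeroʳ _ ⟩
    𝟙                     ∎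

  ≤-refl : ∀ x → x ≤ x
  ≤-refl = ~x⊕x≡𝟙

  ≤-minimum : ∀ x → 𝟘 ≤ x
  ≤-minimum x = trans (⊕-comm (~ 𝟘) x) (trans (⊕-abs x) (sym 𝟙-def))

  x≤x⊕y : ∀ x y → x ≤ x ⊕ y
  x≤x⊕y x y = begin
    ~ x ⊕ (x ⊕ y)   ≡⟨ ⊕-assoc (~ x) x y ⟩
    (~ x ⊕ x) ⊕ y   ≡⟨ cong (_⊕ y) (~x⊕x≡𝟙 x) ⟩
    𝟙 ⊕ y           ≡⟨ ⊕-zeroˡ y ⟩
    𝟙               ∎

  x⊕z≡y⇒x≤y : ∀ {x y} z → x ⊕ z ≡ y → x ≤ y
  x⊕z≡y⇒x≤y {x} z refl = x≤x⊕y x z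

  x≤y⇒x⊕[y⊖x]≡y : ∀ {x y} → x ≤ y → x ⊕ (y ⊖ x) ≡ y
  x≤y⇒x⊕[y⊖x]≡y {x} {y} x≤y = begin
    x ⊕ (y ⊙ ~ x)         ≡⟨ cong (x ⊕_) (⊙-def y (~ x)) ⟩
    x ⊕ ~ (~ y ⊕ ~ ~ x)   ≡⟨ cong (λ t → x ⊕ ~ (~ y ⊕ t)) (~~ x) ⟩
    x ⊕ ~ (~ y ⊕ x)       ≡⟨ ⊕-comm x _ ⟩
    ~ (~ y ⊕ x) ⊕ x       ≡⟨ sym (łuk x y) ⟩
    ~ (~ x ⊕ y) ⊕ y       ≡⟨ cong (λ t → ~ t ⊕ y) x≤y ⟩
    ~ 𝟙 ⊕ y               ≡⟨ cong (_⊕ y) ~𝟙≡𝟘 ⟩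
    𝟘 ⊕ y                 ≡⟨ ⊕-identityˡ y ⟩
    y                     ∎

  ≤-trans : ∀ {x y z} → x ≤ y → y ≤ z → x ≤ z
  ≤-trans {x} {y} {z} x≤y y≤z = x⊕z≡y⇒x≤y ((y ⊖ x) ⊕ (z ⊖ y)) (begin
    x ⊕ ((y ⊖ x) ⊕ (z ⊖ y))   ≡⟨ ⊕-assoc x _ _ ⟩
    (x ⊕ (y ⊖ x)) ⊕ (z ⊖ y)   ≡⟨ cong (_⊕ (z ⊖ y)) (x≤y⇒x⊕[y⊖x]≡y x≤y) ⟩
    y ⊕ (z ⊖ y)               ≡⟨ x≤y⇒x⊕[y⊖x]≡y y≤z ⟩
    z                         ∎)

  ≤-antisym : ∀ {x y} → x ≤ y → y ≤ x → x ≡ y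
  ≤-antisym {x} {y} x≤y y≤x = begin
    x                   ≡⟨ sym (join-of-≤ y≤x) ⟩
    ~ (~ y ⊕ x) ⊕ x     ≡⟨ sym (łuk x y) ⟩
    ~ (~ x ⊕ y) ⊕ y     ≡⟨ join-of-≤ x≤y ⟩
    y                   ∎
    where
    join-of-≤ : ∀ {u v} → u ≤ v → ~ (~ u ⊕ v) ⊕ v ≡ v
    join-of-≤ {u} {v} u≤v =
      trans (cong (λ t → ~ t ⊕ v) u≤v) (trans (cong (_⊕ v) ~𝟙≡𝟘) (⊕-identityˡ v))

  ⊕-monoˡ-≤ : ∀ {x y} z → x ≤ y → x ⊕ z ≤ y ⊕ z
  ⊕-monoˡ-≤ {x} {y} z x≤y = x⊕z≡y⇒x≤y (y ⊖ x) (begin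
    (x ⊕ z) ⊕ (y ⊖ x)   ≡⟨ sym (⊕-assoc x z _) ⟩
    x ⊕ (z ⊕ (y ⊖ x))   ≡⟨ cong (x ⊕_) (⊕-comm z _) ⟩
    x ⊕ ((y ⊖ x) ⊕ z)   ≡⟨ ⊕-assoc x _ z ⟩
    (x ⊕ (y ⊖ x)) ⊕ z   ≡⟨ cong (_⊕ z) (x≤y⇒x⊕[y⊖x]≡y x≤y) ⟩
    y ⊕ z               ∎)

  ⊕-monoʳ-≤ : ∀ {x y} z → x ≤ y → z ⊕ x ≤ z ⊕ y
  ⊕-monoʳ-≤ {x} {y} z x≤y = subst₂ _≤_ (⊕-comm x z) (⊕-comm y z) (⊕-monoˡ-≤ z x≤y)

  ⊕-mono-≤ : ∀ {x y z w} → x ≤ y → z ≤ w → x ⊕ z ≤ y ⊕ w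
  ⊕-mono-≤ {y = y} {z = z} x≤y z≤w = ≤-trans (⊕-monoˡ-≤ z x≤y) (⊕-monoʳ-≤ y z≤w)

  ~-antitone : ∀ {x y} → x ≤ y → ~ y ≤ ~ x
  ~-antitone {x} {y} x≤y = trans (cong (_⊕ ~ x) (~~ y)) (trans (⊕-comm y (~ x)) x≤y)

  ⊙-mono-≤ : ∀ {x y z w} → x ≤ y → z ≤ w → x ⊙ z ≤ y ⊙ w
  ⊙-mono-≤ {x} {y} {z} {w} x≤y z≤w = subst₂ _≤_ (sym (⊙-def x z)) (sym (⊙-def y w))
    (~-antitone (⊕-mono-≤ (~-antitone x≤y) (~-antitone z≤w)))

  x⊙y≤x : ∀ x y → x ⊙ y ≤ x
  x⊙y≤x x y = begin
    ~ (x ⊙ y) ⊕ x     ≡⟨ cong (_⊕ x) (~-⊙ x y) ⟩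
    (~ x ⊕ ~ y) ⊕ x   ≡⟨ ⊕-comm _ x ⟩
    x ⊕ (~ x ⊕ ~ y)   ≡⟨ ⊕-assoc x (~ x) (~ y) ⟩
    (x ⊕ ~ x) ⊕ ~ y   ≡⟨ cong (_⊕ ~ y) (trans (⊕-comm x (~ x)) (~x⊕x≡𝟙 x)) ⟩
    𝟙 ⊕ ~ y           ≡⟨ ⊕-zeroˡ (~ y) ⟩
    𝟙                 ∎

  [x⊕y]⊖x≤y : ∀ x y → (x ⊕ y) ⊖ x ≤ y
  [x⊕y]⊖x≤y x y = begin
    ~ ((x ⊕ y) ⊙ ~ x) ⊕ y       ≡⟨ cong (_⊕ y) (~-⊙ (x ⊕ y) (~ x)) ⟩
    (~ (x ⊕ y) ⊕ ~ ~ x) ⊕ y     ≡⟨ cong (λ t → (~ (x ⊕ y) ⊕ t) ⊕ y) (~~ x) ⟩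
    (~ (x ⊕ y) ⊕ x) ⊕ y         ≡⟨ sym (⊕-assoc _ x y) ⟩
    ~ (x ⊕ y) ⊕ (x ⊕ y)         ≡⟨ ~x⊕x≡𝟙 (x ⊕ y) ⟩
    𝟙                           ∎

  x≤y⇒x⊖y≡𝟘 : ∀ {x y} → x ≤ y → x ⊖ y ≡ 𝟘
  x≤y⇒x⊖y≡𝟘 {x} {y} x≤y = begin
    x ⊙ ~ y             ≡⟨ ⊙-def x (~ y) ⟩
    ~ (~ x ⊕ ~ ~ y)     ≡⟨ cong (λ t → ~ (~ x ⊕ t)) (~~ y) ⟩
    ~ (~ x ⊕ y)         ≡⟨ cong ~_ x≤y ⟩
    ~ 𝟙                 ≡⟨ ~𝟙≡𝟘 ⟩
    𝟘                   ∎

  -- x ⊙ (~ x ⊕ y) is the meet of x and y.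
  y≤x⇒x⊙[~x⊕y]≡y : ∀ {x y} → y ≤ x → x ⊙ (~ x ⊕ y) ≡ y
  y≤x⇒x⊙[~x⊕y]≡y {x} {y} y≤x = begin
    x ⊙ (~ x ⊕ y)           ≡⟨ ⊙-def x _ ⟩
    ~ (~ x ⊕ ~ (~ x ⊕ y))   ≡⟨ cong ~_ (⊕-comm (~ x) _) ⟩
    ~ (~ (~ x ⊕ y) ⊕ ~ x)   ≡⟨ cong ~_ ~[~x⊕y]⊕~x≡~y ⟩
    ~ ~ y                   ≡⟨ ~~ y ⟩
    y                       ∎
    where
    ~[~x⊕y]⊕~x≡~y : ~ (~ x ⊕ y) ⊕ ~ x ≡ ~ y
    ~[~x⊕y]⊕~x≡~y = begin
      ~ (~ x ⊕ y) ⊕ ~ x       ≡⟨ cong (λ t → ~ t ⊕ ~ x)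
                                   (trans (⊕-comm (~ x) y) (cong (_⊕ ~ x) (sym (~~ y)))) ⟩
      ~ (~ ~ y ⊕ ~ x) ⊕ ~ x   ≡⟨ łuk (~ y) (~ x) ⟩
      ~ (~ ~ x ⊕ ~ y) ⊕ ~ y   ≡⟨ cong (λ t → ~ (t ⊕ ~ y) ⊕ ~ y) (~~ x) ⟩
      ~ (x ⊕ ~ y) ⊕ ~ y       ≡⟨ cong (λ t → ~ t ⊕ ~ y) (trans (⊕-comm x (~ y)) y≤x) ⟩
      ~ 𝟙 ⊕ ~ y               ≡⟨ cong (_⊕ ~ y) ~𝟙≡𝟘 ⟩
      𝟘 ⊕ ~ y                 ≡⟨ ⊕-identityˡ (~ y) ⟩
      ~ y                     ∎

  riesz-decomposition : ∀ {ξ p q} → ξ ≤ p ⊕ q → ∃₂ λ u v → u ≤ p × v ≤ q × ξ ≡ u ⊕ v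
  riesz-decomposition {ξ} {p} {q} ξ≤p⊕q = u , v , u≤p , v≤q , ξ≡u⊕v
    where
    u v : Carrier
    u = ξ ⊙ (~ ξ ⊕ p)
    v = ξ ⊖ p

    u≤p : u ≤ p
    u≤p = begin
      ~ u ⊕ p                         ≡⟨ cong (_⊕ p) (~-⊙ ξ _) ⟩
      (~ ξ ⊕ ~ (~ ξ ⊕ p)) ⊕ p         ≡⟨ sym (⊕-assoc (~ ξ) _ p) ⟩
      ~ ξ ⊕ (~ (~ ξ ⊕ p) ⊕ p)         ≡⟨ cong (~ ξ ⊕_) (trans (łuk ξ p) (⊕-comm _ ξ)) ⟩
      ~ ξ ⊕ (ξ ⊕ ~ (~ p ⊕ ξ))         ≡⟨ ⊕-assoc (~ ξ) ξ _ ⟩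
      (~ ξ ⊕ ξ) ⊕ ~ (~ p ⊕ ξ)         ≡⟨ cong (_⊕ _) (~x⊕x≡𝟙 ξ) ⟩
      𝟙 ⊕ ~ (~ p ⊕ ξ)                 ≡⟨ ⊕-zeroˡ _ ⟩
      𝟙                               ∎

    v≤q : v ≤ q
    v≤q = ≤-trans (⊙-mono-≤ ξ≤p⊕q (≤-refl (~ p))) ([x⊕y]⊖x≤y p q)

    ~u≡~ξ⊕v : ~ u ≡ ~ ξ ⊕ v
    ~u≡~ξ⊕v = trans (~-⊙ ξ _) (cong (~ ξ ⊕_) (trans (~-⊕ (~ ξ) p) (cong (_⊙ ~ p) (~~ ξ))))

    ξ≡u⊕v : ξ ≡ u ⊕ v
    ξ≡u⊕v = begin
      ξ                     ≡⟨ sym (x≤y⇒x⊕[y⊖x]≡y (x⊙y≤x ξ (~ ξ ⊕ p))) ⟩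
      u ⊕ (ξ ⊙ ~ u)         ≡⟨ cong (λ t → u ⊕ (ξ ⊙ t)) ~u≡~ξ⊕v ⟩
      u ⊕ (ξ ⊙ (~ ξ ⊕ v))   ≡⟨ cong (u ⊕_) (y≤x⇒x⊙[~x⊕y]≡y (x⊙y≤x ξ (~ p))) ⟩
      u ⊕ v                 ∎

  -- Decompose ξ ⊖ (α ⊕ γ) ≤ (β ⊖ α) ⊕ (δ ⊖ γ) and add α and γ back.
  ⊕-decompose-between : ∀ {α β γ δ ξ} → α ≤ β → γ ≤ δ → α ⊕ γ ≤ ξ → ξ ≤ β ⊕ δ →
    ∃₂ λ u v → (α ≤ u × u ≤ β) × (γ ≤ v × v ≤ δ) × ξ ≡ u ⊕ v
  ⊕-decompose-between {α} {β} {γ} {δ} {ξ} α≤β γ≤δ α⊕γ≤ξ ξ≤β⊕δ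
    with riesz-decomposition ξ⊖[α⊕γ]≤[β⊖α]⊕[δ⊖γ]
    where
    β⊕δ-split : (α ⊕ γ) ⊕ ((β ⊖ α) ⊕ (δ ⊖ γ)) ≡ β ⊕ δ
    β⊕δ-split = trans (⊕-interchange α γ _ _)
      (cong₂ _⊕_ (x≤y⇒x⊕[y⊖x]≡y α≤β) (x≤y⇒x⊕[y⊖x]≡y γ≤δ))

    ξ⊖[α⊕γ]≤[β⊖α]⊕[δ⊖γ] : ξ ⊖ (α ⊕ γ) ≤ (β ⊖ α) ⊕ (δ ⊖ γ)
    ξ⊖[α⊕γ]≤[β⊖α]⊕[δ⊖γ] = ≤-trans (⊙-mono-≤ ξ≤β⊕δ (≤-refl _))
      (subst (λ t → t ⊖ (α ⊕ γ) ≤ (β ⊖ α) ⊕ (δ ⊖ γ)) β⊕δ-split ([x⊕y]⊖x≤y (α ⊕ γ) _))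
  ... | u , v , u≤β⊖α , v≤δ⊖γ , ξ⊖[α⊕γ]≡u⊕v =
    α ⊕ u , γ ⊕ v ,
    (x≤x⊕y α u , subst (α ⊕ u ≤_) (x≤y⇒x⊕[y⊖x]≡y α≤β) (⊕-monoʳ-≤ α u≤β⊖α)) ,
    (x≤x⊕y γ v , subst (γ ⊕ v ≤_) (x≤y⇒x⊕[y⊖x]≡y γ≤δ) (⊕-monoʳ-≤ γ v≤δ⊖γ)) ,
    (begin
      ξ                           ≡⟨ sym (x≤y⇒x⊕[y⊖x]≡y α⊕γ≤ξ) ⟩
      (α ⊕ γ) ⊕ (ξ ⊖ (α ⊕ γ))     ≡⟨ cong ((α ⊕ γ) ⊕_) ξ⊖[α⊕γ]≡u⊕v ⟩
      (α ⊕ γ) ⊕ (u ⊕ v)           ≡⟨ ⊕-interchange α γ u v ⟩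
      (α ⊕ u) ⊕ (γ ⊕ v)           ∎)

module IntervalProperties {a : Level} (A : MVAlgebra a) where
  open MVAlgebra A renaming (_≤_ to infix 4 _≤_)
  open MVProperties A
  open Intervals A

  infix 4 _≐⟦_,_⟧
  _≐⟦_,_⟧ : Subset → Carrier → Carrier → Set a
  x ≐⟦ α , β ⟧ = α ≤ β × x ≐ ⟦ α , β ⟧

  endpoints-unique : ∀ {α β α′ β′} → α ≤ β → α′ ≤ β′ → ⟦ α , β ⟧ ≐ ⟦ α′ , β′ ⟧ →
    α ≡ α′ × β ≡ β′
  endpoints-unique {α} {β} {α′} {β′} α≤β α′≤β′ (⊆′ , ⊇′) =
    ≤-antisym (proj₁ (⊇′ (≤-refl α′ , α′≤β′))) (proj₁ (⊆′ (≤-refl α , α≤β))) ,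
    ≤-antisym (proj₂ (⊆′ (α≤β , ≤-refl β))) (proj₂ (⊇′ (α′≤β′ , ≤-refl β′)))

  ≐-by-endpoints : ∀ {x y α β α′ β′} → x ≐⟦ α , β ⟧ → y ≐⟦ α′ , β′ ⟧ →
    α ≡ α′ → β ≡ β′ → x ≐ y
  ≐-by-endpoints (_ , x≐) (_ , y≐) refl refl = ≐-trans x≐ (≐-sym y≐)

  I0-endpoints : I0 ≐⟦ 𝟘 , 𝟘 ⟧
  I0-endpoints = ≤-refl 𝟘 , ≐-refl

  I1-endpoints : I1 ≐⟦ 𝟙 , 𝟙 ⟧
  I1-endpoints = ≤-refl 𝟙 , ≐-refl

  Iι-endpoints : Iι ≐⟦ 𝟘 , 𝟙 ⟧
  Iι-endpoints = ≤-minimum 𝟙 , ≐-refl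

  I¬-endpoints : ∀ {x α β} → x ≐⟦ α , β ⟧ → I¬ x ≐⟦ ~ β , ~ α ⟧
  I¬-endpoints {x} {α} {β} (α≤β , x⊆ , x⊇) = ~-antitone α≤β , forth , back
    where
    forth : I¬ x ⊆ ⟦ ~ β , ~ α ⟧
    forth (ξ , ξ∈x , refl) = ~-antitone (proj₂ (x⊆ ξ∈x)) , ~-antitone (proj₁ (x⊆ ξ∈x))

    back : ⟦ ~ β , ~ α ⟧ ⊆ I¬ x
    back {ξ} (~β≤ξ , ξ≤~α) =
      ~ ξ ,
      x⊇ (subst (_≤ ~ ξ) (~~ α) (~-antitone ξ≤~α) , subst (~ ξ ≤_) (~~ β) (~-antitone ~β≤ξ)) ,
      sym (~~ ξ)

  I⊕-endpoints : ∀ {x y α β γ δ} → x ≐⟦ α , β ⟧ → y ≐⟦ γ , δ ⟧ →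
    x I⊕ y ≐⟦ α ⊕ γ , β ⊕ δ ⟧
  I⊕-endpoints {x} {y} {α} {β} {γ} {δ} (α≤β , x⊆ , x⊇) (γ≤δ , y⊆ , y⊇) =
    ⊕-mono-≤ α≤β γ≤δ , forth , back
    where
    forth : x I⊕ y ⊆ ⟦ α ⊕ γ , β ⊕ δ ⟧
    forth (u , v , u∈x , v∈y , refl) =
      ⊕-mono-≤ (proj₁ (x⊆ u∈x)) (proj₁ (y⊆ v∈y)) , ⊕-mono-≤ (proj₂ (x⊆ u∈x)) (proj₂ (y⊆ v∈y))

    back : ⟦ α ⊕ γ , β ⊕ δ ⟧ ⊆ x I⊕ y
    back (lower , upper) with ⊕-decompose-between α≤β γ≤δ lower upper
    ... | u , v , u∈[α,β] , v∈[γ,δ] , ξ≡u⊕v = u , v , x⊇ u∈[α,β] , y⊇ v∈[γ,δ] , ξ≡u⊕v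

  I⊙≐I¬[I¬I⊕I¬] : ∀ x y → x I⊙ y ≐ I¬ (I¬ x I⊕ I¬ y)
  I⊙≐I¬[I¬I⊕I¬] x y = forth , back
    where
    forth : x I⊙ y ⊆ I¬ (I¬ x I⊕ I¬ y)
    forth (u , v , u∈x , v∈y , refl) =
      ~ u ⊕ ~ v , (~ u , ~ v , (u , u∈x , refl) , (v , v∈y , refl) , refl) , ⊙-def u v

    back : I¬ (I¬ x I⊕ I¬ y) ⊆ x I⊙ y
    back (_ , (_ , _ , (u , u∈x , refl) , (v , v∈y , refl) , refl) , refl) =
      u , v , u∈x , v∈y , sym (⊙-def u v)

  I⊙-endpoints : ∀ {x y α β γ δ} → x ≐⟦ α , β ⟧ → y ≐⟦ γ , δ ⟧ →
    x I⊙ y ≐⟦ α ⊙ γ , β ⊙ δ ⟧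
  I⊙-endpoints {x} {y} {α} {β} {γ} {δ} x≐ y≐
    with I¬-endpoints (I⊕-endpoints (I¬-endpoints x≐) (I¬-endpoints y≐))
  ... | lower≤upper , x⊙y≐′ rewrite sym (⊙-def α γ) | sym (⊙-def β δ) =
    lower≤upper , ≐-trans (I⊙≐I¬[I¬I⊕I¬] x y) x⊙y≐′

  -- IΔ and I∇ accept every presentation of x; uniqueness of endpoints makes them well defined.
  IΔ-endpoints : ∀ {x α β} → x ≐⟦ α , β ⟧ → IΔ x ≐⟦ α , α ⟧
  IΔ-endpoints {x} {α} {β} (α≤β , x≐) = ≤-refl α , forth , back
    where
    forth : IΔ x ⊆ ⟦ α , α ⟧
    forth (α′ , β′ , α′≤β′ , x≐′ , ξ∈[α′,α′]) =
      subst (λ t → ⟦ t , t ⟧ _) (proj₁ (endpoints-unique α′≤β′ α≤β (≐-trans (≐-sym x≐′) x≐)))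
        ξ∈[α′,α′]

    back : ⟦ α , α ⟧ ⊆ IΔ x
    back ξ∈[α,α] = α , β , α≤β , x≐ , ξ∈[α,α]

  I∇-endpoints : ∀ {x α β} → x ≐⟦ α , β ⟧ → I∇ x ≐⟦ β , β ⟧
  I∇-endpoints {x} {α} {β} (α≤β , x≐) = ≤-refl β , forth , back
    where
    forth : I∇ x ⊆ ⟦ β , β ⟧
    forth (α′ , β′ , α′≤β′ , x≐′ , ξ∈[β′,β′]) =
      subst (λ t → ⟦ t , t ⟧ _) (proj₂ (endpoints-unique α′≤β′ α≤β (≐-trans (≐-sym x≐′) x≐)))
        ξ∈[β′,β′]

    back : ⟦ β , β ⟧ ⊆ I∇ x
    back ξ∈[β,β] = α , β , α≤β , x≐ , ξ∈[β,β]

proposition2p2 : {a : Level} (A : MVAlgebra a) →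
    let open Intervals A in
    ∀ x y z → IsInterval x → IsInterval y → IsInterval z →
      (x I⊕ (y I⊕ z) ≐ (x I⊕ y) I⊕ z)
      × (x I⊕ y ≐ y I⊕ x)
      × (x I⊕ I0 ≐ x)
      × (x I⊕ I¬ I0 ≐ I¬ I0)
      × (I¬ (I¬ x) ≐ x)
      × (I¬ (I¬ (IΔ x) I⊕ IΔ y) I⊕ IΔ y ≐ I¬ (I¬ (IΔ y) I⊕ IΔ x) I⊕ IΔ x)
      × (x I⊙ y ≐ I¬ (I¬ x I⊕ I¬ y))
      × (I1 ≐ I¬ I0)
      × (I∇ x ≐ I¬ (IΔ (I¬ x)))
      × (I¬ Iι ≐ Iι)
      × (IΔ I0 ≐ I0)
      × (IΔ I1 ≐ I1)
      × (IΔ Iι ≐ I0)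
      × (IΔ (IΔ x) ≐ IΔ x)
      × (IΔ (I∇ x) ≐ I∇ x)
      × (IΔ (x I⊕ y) ≐ IΔ x I⊕ IΔ y)
      × (IΔ (x I⊙ y) ≐ IΔ x I⊙ IΔ y)
      × (IΔ x I⊙ I¬ (I∇ x) ≐ I0)
      × (IΔ x I⊕ ((Iι I⊙ I∇ x) I⊙ I¬ (IΔ x)) ≐ x)
proposition2p2 A x y z (α , β , x≐) (γ , δ , y≐) (ε , ζ , z≐) =
  ≐-by-endpoints (I⊕-endpoints x≐ (I⊕-endpoints y≐ z≐)) (I⊕-endpoints (I⊕-endpoints x≐ y≐) z≐)
    (⊕-assoc α γ ε) (⊕-assoc β δ ζ) ,
  ≐-by-endpoints (I⊕-endpoints x≐ y≐) (I⊕-endpoints y≐ x≐) (⊕-comm α γ) (⊕-comm β δ) ,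
  ≐-by-endpoints (I⊕-endpoints x≐ I0-endpoints) x≐ (⊕-id α) (⊕-id β) ,
  ≐-by-endpoints (I⊕-endpoints x≐ (I¬-endpoints I0-endpoints)) (I¬-endpoints I0-endpoints)
    (⊕-abs α) (⊕-abs β) ,
  ≐-by-endpoints (I¬-endpoints (I¬-endpoints x≐)) x≐ (~~ α) (~~ β) ,
  ≐-by-endpoints (łuk-endpoints x≐ y≐) (łuk-endpoints y≐ x≐) (łuk α γ) (łuk α γ) ,
  I⊙≐I¬[I¬I⊕I¬] x y ,
  ≐-by-endpoints I1-endpoints (I¬-endpoints I0-endpoints) 𝟙-def 𝟙-def ,
  ≐-by-endpoints (I∇-endpoints x≐) (I¬-endpoints (IΔ-endpoints (I¬-endpoints x≐)))
    (sym (~~ β)) (sym (~~ β)) ,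
  ≐-by-endpoints (I¬-endpoints Iι-endpoints) Iι-endpoints ~𝟙≡𝟘 (sym 𝟙-def) ,
  ≐-by-endpoints (IΔ-endpoints I0-endpoints) I0-endpoints refl refl ,
  ≐-by-endpoints (IΔ-endpoints I1-endpoints) I1-endpoints refl refl ,
  ≐-by-endpoints (IΔ-endpoints Iι-endpoints) I0-endpoints refl refl ,
  ≐-by-endpoints (IΔ-endpoints (IΔ-endpoints x≐)) (IΔ-endpoints x≐) refl refl ,
  ≐-by-endpoints (IΔ-endpoints (I∇-endpoints x≐)) (I∇-endpoints x≐) refl refl ,
  ≐-by-endpoints (IΔ-endpoints (I⊕-endpoints x≐ y≐))
    (I⊕-endpoints (IΔ-endpoints x≐) (IΔ-endpoints y≐)) refl refl ,
  ≐-by-endpoints (IΔ-endpoints (I⊙-endpoints x≐ y≐))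
    (I⊙-endpoints (IΔ-endpoints x≐) (IΔ-endpoints y≐)) refl refl ,
  ≐-by-endpoints (I⊙-endpoints (IΔ-endpoints x≐) (I¬-endpoints (I∇-endpoints x≐))) I0-endpoints
    (x≤y⇒x⊖y≡𝟘 (proj₁ x≐)) (x≤y⇒x⊖y≡𝟘 (proj₁ x≐)) ,
  ≐-by-endpoints
    (I⊕-endpoints (IΔ-endpoints x≐)
      (I⊙-endpoints (I⊙-endpoints Iι-endpoints (I∇-endpoints x≐)) (I¬-endpoints (IΔ-endpoints x≐))))
    x≐ lower upper
  where
  open MVAlgebra A
  open MVProperties A
  open IntervalProperties A
  open Intervals A

  łuk-endpoints : ∀ {u v α β γ δ} → u ≐⟦ α , β ⟧ → v ≐⟦ γ , δ ⟧ →
    I¬ (I¬ (IΔ u) I⊕ IΔ v) I⊕ IΔ v ≐⟦ ~ (~ α ⊕ γ) ⊕ γ , ~ (~ α ⊕ γ) ⊕ γ ⟧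
  łuk-endpoints u≐ v≐ =
    I⊕-endpoints (I¬-endpoints (I⊕-endpoints (I¬-endpoints (IΔ-endpoints u≐)) (IΔ-endpoints v≐)))
      (IΔ-endpoints v≐)

  lower : α ⊕ ((𝟘 ⊙ β) ⊖ α) ≡ α
  lower = trans (cong (λ t → α ⊕ (t ⊖ α)) (⊙-zeroˡ β)) (trans (cong (α ⊕_) (⊙-zeroˡ _)) (⊕-id α))

  upper : α ⊕ ((𝟙 ⊙ β) ⊖ α) ≡ β
  upper = trans (cong (λ t → α ⊕ (t ⊖ α)) (⊙-identityˡ β)) (x≤y⇒x⊕[y⊖x]≡y (proj₁ x≐))
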